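{- Let $T$ be a (complete) first-order theory in signature $\tau$ and $S$ its core companion. Let $\mathfrak B$ be a model of $S$ and let $\mathfrak t\colon\mathfrak B\to\mathfrak A$ be a homomorphism into a model $\mathfrak A$ of $T$. Then $\mathfrak t$ is a trace definition of $\mathfrak B$ in $\mathfrak A$. In particular, $T$ trace defines $S$.
   Context: A theory $S$ is a model-complete core theory if every homomorphism between models of $S$ is an elementary embedding (equivalently, every formula is equivalent modulo $S$ to an existential positive formula). $S$ is the core companion of $T$ if $S$ is a model-complete core theory and $S$ and $T$ have the same $h$-universal consequences (sentences $\forall\bar x(\phi(\bar x)\to\bot)$ with $\phi$ positive quantifier-free). For structures $\mathfrak A$ (signature $\sigma$) and $\mathfrak B$ (signature $\tau$), a trace definition of $\mathfrak B$ in $\mathfrak A$ is a map $\mathfrak t\colon B\to A^m$ for some $m$ such that for every $\tau$-formula $\phi(\bar x)$ with parameters from $B$, $|\bar x|=n$, there is a $\sigma$-formula $\psi(\bar y)$ with parameters from $A$, $|\bar y|=nm$, such that for all $\bar a\in B^n$: $\mathfrak B\models\phi(\bar a)$ iff $\mathfrak A\models\psi(\mathfrak t(\bar a))$. A complete theory $T$ trace defines a complete theory $S$ if some model of $S$ is trace definable in some model of $T$. -}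

module Defs where

open import Level using (Level; Lift; 0ℓ) renaming (suc to lsuc)
open import Data.Nat using (ℕ; zero; suc; _+_; _*_)
open import Data.Fin using (Fin)
open import Data.Vec using (Vec; []; _∷_; _++_; map; lookup; concat)
open import Data.Product using (Σ; _×_)
open import Data.Sum using (_⊎_)
open import Data.Empty using (⊥)
open import Data.Unit using (⊤)
open import Function.Bundles using (_⇔_)
open import Relation.Binary.PropositionalEquality using (_≡_)

record Signature : Set₁ where
  field
    Fun      : Set
    funArity : Fun → ℕ
    Rel      : Set
    relArity : Rel → ℕ
open Signature public

-- Terms and formulas in de Bruijn style: n = number of free variables.

data Term (σ : Signature) (n : ℕ) : Set where
  var : Fin n → Term σ n
  app : (f : Fun σ) → Vec (Term σ n) (funArity σ f) → Term σ n

data Formula (σ : Signature) : ℕ → Set where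
  tt'  : ∀ {n} → Formula σ n
  ff'  : ∀ {n} → Formula σ n
  rel  : ∀ {n} (R : Rel σ) → Vec (Term σ n) (relArity σ R) → Formula σ n
  _≐_  : ∀ {n} → Term σ n → Term σ n → Formula σ n
  ¬'_  : ∀ {n} → Formula σ n → Formula σ n
  _∧'_ : ∀ {n} → Formula σ n → Formula σ n → Formula σ n
  _∨'_ : ∀ {n} → Formula σ n → Formula σ n → Formula σ n
  _⇒'_ : ∀ {n} → Formula σ n → Formula σ n → Formula σ n
  ∀'_  : ∀ {n} → Formula σ (suc n) → Formula σ n
  ∃'_  : ∀ {n} → Formula σ (suc n) → Formula σ n

Sentence : Signature → Set
Sentence σ = Formula σ 0

-- Structures and Tarskian satisfaction (variable 0 = innermost binder)

record Structure (σ : Signature) (ℓ : Level) : Set (lsuc ℓ) where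
  field
    Carrier : Set ℓ
    funI    : (f : Fun σ) → Vec Carrier (funArity σ f) → Carrier
    relI    : (R : Rel σ) → Vec Carrier (relArity σ R) → Set ℓ
open Structure public

module _ {σ : Signature} {ℓ : Level} (M : Structure σ ℓ) where

  mutual
    evalT : ∀ {n} → Term σ n → Vec (Carrier M) n → Carrier M
    evalT (var i)    ρ = lookup ρ i
    evalT (app f ts) ρ = funI M f (evalTs ts ρ)

    evalTs : ∀ {n k} → Vec (Term σ n) k → Vec (Carrier M) n → Vec (Carrier M) k
    evalTs []       ρ = []
    evalTs (t ∷ ts) ρ = evalT t ρ ∷ evalTs ts ρ

  Sat : ∀ {n} → Formula σ n → Vec (Carrier M) n → Set ℓ
  Sat tt'        ρ = Lift ℓ ⊤
  Sat ff'        ρ = Lift ℓ ⊥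
  Sat (rel R ts) ρ = relI M R (evalTs ts ρ)
  Sat (s ≐ t)    ρ = evalT s ρ ≡ evalT t ρ
  Sat (¬' φ)     ρ = Sat φ ρ → Lift ℓ ⊥
  Sat (φ ∧' ψ)   ρ = Sat φ ρ × Sat ψ ρ
  Sat (φ ∨' ψ)   ρ = Sat φ ρ ⊎ Sat ψ ρ
  Sat (φ ⇒' ψ)   ρ = Sat φ ρ → Sat ψ ρ
  Sat (∀' φ)     ρ = (a : Carrier M) → Sat φ (a ∷ ρ)
  Sat (∃' φ)     ρ = Σ (Carrier M) λ a → Sat φ (a ∷ ρ)

Theory : Signature → Set₁
Theory σ = Sentence σ → Set

Model : ∀ {σ ℓ} → Structure σ ℓ → Theory σ → Set ℓ
Model M T = ∀ φ → T φ → Sat M φ []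

_⊨[_]_ : ∀ {σ} → Theory σ → (ℓ : Level) → Sentence σ → Set (lsuc ℓ)
_⊨[_]_ {σ} T ℓ φ = (M : Structure σ ℓ) → Model M T → Sat M φ []

Complete : ∀ {σ} (ℓ : Level) → Theory σ → Set (lsuc ℓ)
Complete ℓ T = ∀ φ → (T ⊨[ ℓ ] φ) ⊎ (T ⊨[ ℓ ] (¬' φ))

data PosQF {σ : Signature} {n : ℕ} : Formula σ n → Set where
  tt'  : PosQF tt'
  ff'  : PosQF ff'
  rel  : ∀ R ts → PosQF (rel R ts)
  eq   : ∀ s t → PosQF (s ≐ t)
  and  : ∀ {φ ψ} → PosQF φ → PosQF ψ → PosQF (φ ∧' ψ)
  or   : ∀ {φ ψ} → PosQF φ → PosQF ψ → PosQF (φ ∨' ψ)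

data ExPos {σ : Signature} : {n : ℕ} → Formula σ n → Set where
  tt'  : ∀ {n} → ExPos {n = n} tt'
  ff'  : ∀ {n} → ExPos {n = n} ff'
  rel  : ∀ {n} R (ts : Vec (Term σ n) (relArity σ R)) → ExPos (rel R ts)
  eq   : ∀ {n} (s t : Term σ n) → ExPos (s ≐ t)
  and  : ∀ {n} {φ ψ : Formula σ n} → ExPos φ → ExPos ψ → ExPos (φ ∧' ψ)
  or   : ∀ {n} {φ ψ : Formula σ n} → ExPos φ → ExPos ψ → ExPos (φ ∨' ψ)
  ex   : ∀ {n} {φ : Formula σ (suc n)} → ExPos φ → ExPos (∃' φ)

closeAll : ∀ {σ} n → Formula σ n → Sentence σ
closeAll zero    φ = φ
closeAll (suc n) φ = closeAll n (∀' φ)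

HUniversal : ∀ {σ} → Sentence σ → Set
HUniversal {σ} χ =
  Σ ℕ λ n → Σ (Formula σ n) λ φ → PosQF φ × (χ ≡ closeAll n (φ ⇒' ff'))

ModelCompleteCore : ∀ {σ} (ℓ : Level) → Theory σ → Set (lsuc ℓ)
ModelCompleteCore {σ} ℓ S =
  ∀ n (φ : Formula σ n) → Σ (Formula σ n) λ ψ → ExPos ψ ×
    ((M : Structure σ ℓ) → Model M S → (ρ : Vec (Carrier M) n) →
       Sat M φ ρ ⇔ Sat M ψ ρ)

SameHUniversal : ∀ {σ} (ℓ : Level) → Theory σ → Theory σ → Set (lsuc ℓ)
SameHUniversal ℓ S T =
  ∀ χ → HUniversal χ → (S ⊨[ ℓ ] χ) ⇔ (T ⊨[ ℓ ] χ)

CoreCompanion : ∀ {σ} (ℓ : Level) → Theory σ → Theory σ → Set (lsuc ℓ)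
CoreCompanion ℓ S T = ModelCompleteCore ℓ S × SameHUniversal ℓ S T

IsHom : ∀ {σ ℓ} (M N : Structure σ ℓ) → (Carrier M → Carrier N) → Set ℓ
IsHom {σ} M N h =
  ((f : Fun σ) (as : Vec (Carrier M) (funArity σ f)) →
     h (funI M f as) ≡ funI N f (map h as)) ×
  ((R : Rel σ) (as : Vec (Carrier M) (relArity σ R)) →
     relI M R as → relI N R (map h as))

-- Trace definitions
-- A formula φ(x̄) with k parameters from B is a formula in n + k free
-- variables (x̄ first) together with a parameter tuple p ∈ B^k.

TraceDef : ∀ {σ τ ℓ} (A : Structure σ ℓ) (B : Structure τ ℓ) (m : ℕ) →
           (Carrier B → Vec (Carrier A) m) → Set ℓ
TraceDef {σ} {τ} A B m t =
  ∀ n k (φ : Formula τ (n + k)) (p : Vec (Carrier B) k) →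
    Σ ℕ λ k′ → Σ (Formula σ (n * m + k′)) λ ψ → Σ (Vec (Carrier A) k′) λ q →
      (as : Vec (Carrier B) n) →
        Sat B φ (as ++ p) ⇔ Sat A ψ (concat (map t as) ++ q)

TraceDefines : ∀ {σ τ} (ℓ : Level) → Theory σ → Theory τ → Set (lsuc ℓ)
TraceDefines {σ} {τ} ℓ T S =
  Σ (Structure τ ℓ) λ B → Model B S × Σ (Structure σ ℓ) λ A → Model A T ×
    Σ ℕ λ m → Σ (Carrier B → Vec (Carrier A) m) λ t → TraceDef A B m t

-- A homomorphism t : 𝔅 → 𝔄 preserves existential positive formulas; the
-- point is that it also reflects them.  If 𝔅 ⊭ ψ(b̄), model-completeness
-- of S gives an existential positive χ equivalent to ¬ψ, so 𝔅 ⊨ χ(b̄) and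
-- hence 𝔄 ⊨ (ψ ∧ χ)(t b̄).  In prenex form ψ ∧ χ is ∃ȳ θ with θ positive
-- quantifier-free, and S ⊨ ∀x̄ȳ (θ → ⊥); this sentence is h-universal, so
-- T proves it as well, contradicting 𝔄 ⊨ T.  As every formula is
-- equivalent modulo S to an existential positive one, the formulas of 𝔅
-- are thus traced along t by existential positive formulas of 𝔄.
module Submission where

open import Defs
open import Level using (Level; lift; lower) renaming (suc to lsuc)
open import Axiom.ExcludedMiddle using (ExcludedMiddle)
open import Data.Nat using (ℕ; zero; suc; _+_; _*_)
open import Data.Nat.Properties using (*-identityʳ)
open import Data.Fin using (Fin; _↑ˡ_; _↑ʳ_) renaming (splitAt to splitAtFin)
open import Data.Vec using (Vec; []; _∷_; _++_; map; lookup; concat; replicate; splitAt; cast)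
open import Data.Vec.Properties using (lookup-++ˡ; lookup-++ʳ; lookup-map; lookup-splitAt)
open import Data.Vec.Relation.Binary.Equality.Cast using (cast-is-id)
open import Data.Product using (Σ; _×_; _,_; proj₁; proj₂)
open import Data.Sum using (inj₁; inj₂; [_,_]′)
open import Data.Empty using (⊥-elim)
open import Data.Unit using (tt)
open import Function.Bundles using (_⇔_; mk⇔; Equivalence)
open import Function.Construct.Identity using (⇔-id)
open import Function.Construct.Composition using (_⇔-∘_)
open import Relation.Nullary using (¬_; yes; no)
open import Relation.Binary.PropositionalEquality
  using (_≡_; refl; sym; trans; cong; cong₂; subst)

open Equivalence using (to; from)

elim-++ : ∀ {a p} {A : Set a} m {n} (P : Vec A (m + n) → Set p) →
          (∀ xs ys → P (xs ++ ys)) → ∀ zs → P zs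
elim-++ m P f zs with splitAt m zs
... | xs , ys , refl = f xs ys

cast-map-++-singletons : {a b : Level} {A : Set a} {B : Set b} (f : A → B) {n k : ℕ} →
  .(e : n + k ≡ n * 1 + k) → (xs : Vec A n) (ys : Vec A k) →
  cast e (map f (xs ++ ys)) ≡ concat (map (λ x → f x ∷ []) xs) ++ map f ys
cast-map-++-singletons f e []       ys = cast-is-id e (map f ys)
cast-map-++-singletons f e (x ∷ xs) ys = cong (f x ∷_) (cast-map-++-singletons f _ xs ys)

extendRen : ∀ m {j k} → (Fin j → Fin k) → Fin (m + j) → Fin (m + k)
extendRen m {k = k} g i = [ _↑ˡ k , (λ y → m ↑ʳ g y) ]′ (splitAtFin m i)

-- Moves the innermost bound variable behind the m outer ones.
moveBinder : ∀ m j → Fin (suc (m + j)) → Fin (m + suc j)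
moveBinder m j Fin.zero    = m ↑ʳ Fin.zero
moveBinder m j (Fin.suc i) = extendRen m Fin.suc i

module _ {a : Level} {A : Set a} where

  lookup-extendRen : ∀ {m j k} (g : Fin j → Fin k) (ρ : Vec A m)
    (ws : Vec A k) (vs : Vec A j) → (∀ i → lookup ws (g i) ≡ lookup vs i) →
    ∀ i → lookup (ρ ++ ws) (extendRen m g i) ≡ lookup (ρ ++ vs) i
  lookup-extendRen {m} g ρ ws vs g-ok i with splitAtFin m i | lookup-splitAt m ρ vs i
  ... | inj₁ x | e = trans (lookup-++ˡ ρ ws x) (sym e)
  ... | inj₂ y | e = trans (lookup-++ʳ ρ ws (g y)) (trans (g-ok y) (sym e))

  lookup-moveBinder : ∀ {m j} (ρ : Vec A m) (x : A) (ys : Vec A j) i →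
    lookup (ρ ++ (x ∷ ys)) (moveBinder m j i) ≡ lookup (x ∷ (ρ ++ ys)) i
  lookup-moveBinder ρ x ys Fin.zero    = lookup-++ʳ ρ (x ∷ ys) Fin.zero
  lookup-moveBinder ρ x ys (Fin.suc i) =
    lookup-extendRen Fin.suc ρ (x ∷ ys) ys (λ _ → refl) i

  lookup-++-[] : ∀ {m} (ρ : Vec A m) (ys : Vec A 0) i →
    lookup (ρ ++ ys) (i ↑ˡ 0) ≡ lookup ρ i
  lookup-++-[] ρ [] i = lookup-++ˡ ρ [] i

module _ {τ : Signature} where

  mutual
    renameT : ∀ {a b} → (Fin a → Fin b) → Term τ a → Term τ b
    renameT r (var i)    = var (r i)
    renameT r (app f ts) = app f (renameTs r ts)

    renameTs : ∀ {a b k} → (Fin a → Fin b) → Vec (Term τ a) k → Vec (Term τ b) k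
    renameTs r []       = []
    renameTs r (t ∷ ts) = renameT r t ∷ renameTs r ts

  renameQF : ∀ {a b} → (Fin a → Fin b) → {φ : Formula τ a} → PosQF φ → Formula τ b
  renameQF r tt'         = tt'
  renameQF r ff'         = ff'
  renameQF r (rel R ts)  = rel R (renameTs r ts)
  renameQF r (eq s t)    = renameT r s ≐ renameT r t
  renameQF r (and p q)   = renameQF r p ∧' renameQF r q
  renameQF r (or p q)    = renameQF r p ∨' renameQF r q

  renameQF-posQF : ∀ {a b} (r : Fin a → Fin b) {φ : Formula τ a} (p : PosQF φ) →
                   PosQF (renameQF r p)
  renameQF-posQF r tt'        = tt'
  renameQF-posQF r ff'        = ff'
  renameQF-posQF r (rel R ts) = rel R _
  renameQF-posQF r (eq s t)   = eq _ _
  renameQF-posQF r (and p q)  = and (renameQF-posQF r p) (renameQF-posQF r q)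
  renameQF-posQF r (or p q)   = or (renameQF-posQF r p) (renameQF-posQF r q)

  module _ {ℓ : Level} (M : Structure τ ℓ) {a b} (r : Fin a → Fin b)
           (w : Vec (Carrier M) b) (ρ : Vec (Carrier M) a)
           (w∘r≗ρ : ∀ i → lookup w (r i) ≡ lookup ρ i) where

    mutual
      evalT-rename : ∀ s → evalT M (renameT r s) w ≡ evalT M s ρ
      evalT-rename (var i)    = w∘r≗ρ i
      evalT-rename (app f ts) = cong (funI M f) (evalTs-rename ts)

      evalTs-rename : ∀ {k} (ts : Vec (Term τ a) k) → evalTs M (renameTs r ts) w ≡ evalTs M ts ρ
      evalTs-rename []       = refl
      evalTs-rename (t ∷ ts) = cong₂ _∷_ (evalT-rename t) (evalTs-rename ts)

    sat-renameQF : ∀ {φ} (p : PosQF φ) → Sat M (renameQF r p) w ⇔ Sat M φ ρ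
    sat-renameQF tt'        = ⇔-id _
    sat-renameQF ff'        = ⇔-id _
    sat-renameQF (rel R ts) = mk⇔ (subst (relI M R) (evalTs-rename ts))
                                  (subst (relI M R) (sym (evalTs-rename ts)))
    sat-renameQF (eq s t)   =
      mk⇔ (λ e → trans (sym (evalT-rename s)) (trans e (evalT-rename t)))
          (λ e → trans (evalT-rename s) (trans e (sym (evalT-rename t))))
    sat-renameQF (and p q)  = mk⇔ (λ (x , y) → to (sat-renameQF p) x , to (sat-renameQF q) y)
                                  (λ (x , y) → from (sat-renameQF p) x , from (sat-renameQF q) y)
    sat-renameQF (or p q)   =
      mk⇔ [ (λ x → inj₁ (to (sat-renameQF p) x)) , (λ y → inj₂ (to (sat-renameQF q) y)) ]′
          [ (λ x → inj₁ (from (sat-renameQF p) x)) , (λ y → inj₂ (from (sat-renameQF q) y)) ]′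

  sat-subst-cast : ∀ {ℓ} (M : Structure τ ℓ) {a b} (e : a ≡ b) (φ : Formula τ a)
    {ρ : Vec (Carrier M) a} {σ : Vec (Carrier M) b} →
    cast e ρ ≡ σ → Sat M φ ρ ⇔ Sat M (subst (Formula τ) e φ) σ
  sat-subst-cast M refl φ {ρ} refl =
    subst (λ σ → Sat M φ ρ ⇔ Sat M φ σ) (sym (cast-is-id refl ρ)) (⇔-id _)

  sat-closeAll : ∀ {ℓ} (M : Structure τ ℓ) n (φ : Formula τ n) →
                 Sat M (closeAll n φ) [] ⇔ (∀ ws → Sat M φ ws)
  sat-closeAll M zero    φ = mk⇔ (λ { x [] → x }) (λ f → f [])
  sat-closeAll M (suc n) φ =
    mk⇔ (λ { x (w ∷ ws) → to (sat-closeAll M n (∀' φ)) x ws w })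
        (λ f → from (sat-closeAll M n (∀' φ)) (λ ws w → f (w ∷ ws)))

  module _ {ℓ : Level} {B A : Structure τ ℓ} {t : Carrier B → Carrier A}
           (t-hom : IsHom B A t) where

    mutual
      evalT-hom : ∀ {n} (s : Term τ n) ρ → t (evalT B s ρ) ≡ evalT A s (map t ρ)
      evalT-hom (var i)    ρ = sym (lookup-map i t ρ)
      evalT-hom (app f ts) ρ = trans (proj₁ t-hom f _) (cong (funI A f) (evalTs-hom ts ρ))

      evalTs-hom : ∀ {n k} (ts : Vec (Term τ n) k) ρ →
                   map t (evalTs B ts ρ) ≡ evalTs A ts (map t ρ)
      evalTs-hom []       ρ = refl
      evalTs-hom (s ∷ ts) ρ = cong₂ _∷_ (evalT-hom s ρ) (evalTs-hom ts ρ)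

    sat-hom-exPos : ∀ {n} {φ : Formula τ n} → ExPos φ → ∀ ρ → Sat B φ ρ → Sat A φ (map t ρ)
    sat-hom-exPos tt'        ρ x       = x
    sat-hom-exPos ff'        ρ x       = lift (lower x)
    sat-hom-exPos (rel R ts) ρ x       = subst (relI A R) (evalTs-hom ts ρ) (proj₂ t-hom R _ x)
    sat-hom-exPos (eq u v)   ρ x       = trans (sym (evalT-hom u ρ)) (trans (cong t x) (evalT-hom v ρ))
    sat-hom-exPos (and p q)  ρ (x , y) = sat-hom-exPos p ρ x , sat-hom-exPos q ρ y
    sat-hom-exPos (or p q)   ρ (inj₁ x) = inj₁ (sat-hom-exPos p ρ x)
    sat-hom-exPos (or p q)   ρ (inj₂ y) = inj₂ (sat-hom-exPos q ρ y)
    sat-hom-exPos (ex p)     ρ (b , x) = t b , sat-hom-exPos p (b ∷ ρ) x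

  -- Producing witnesses needs an element of the structure: a disjunct
  -- that does not hold still needs values for its own bound variables.
  record Prenex (ℓ : Level) {m : ℕ} (φ : Formula τ m) : Set (lsuc ℓ) where
    field
      width  : ℕ
      {θ}    : Formula τ (m + width)
      matrix : PosQF θ
      sound  : (M : Structure τ ℓ) (ρ : Vec (Carrier M) m) (ys : Vec (Carrier M) width) →
               Sat M θ (ρ ++ ys) → Sat M φ ρ
      witness : (M : Structure τ ℓ) → Carrier M → (ρ : Vec (Carrier M) m) →
                Sat M φ ρ → Σ (Vec (Carrier M) width) λ ys → Sat M θ (ρ ++ ys)

  module _ {ℓ : Level} where
    open Prenex

    prenex-posQF : ∀ {m} {φ : Formula τ m} → PosQF φ → Prenex ℓ φ
    prenex-posQF {m} p = record
      { width   = 0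
      ; matrix  = renameQF-posQF (_↑ˡ 0) p
      ; sound   = λ M ρ ys → to (sat-renameQF M _ (ρ ++ ys) ρ (lookup-++-[] ρ ys) p)
      ; witness = λ M _ ρ x → [] , from (sat-renameQF M _ (ρ ++ []) ρ (lookup-++-[] ρ []) p) x }

    module _ {m} {φ ψ : Formula τ m} (P : Prenex ℓ φ) (Q : Prenex ℓ ψ) where
      private
        j k : ℕ
        j = width P
        k = width Q
        renameP : Formula τ (m + (j + k))
        renameP = renameQF (extendRen m (_↑ˡ k)) (matrix P)
        renameQ : Formula τ (m + (j + k))
        renameQ = renameQF (extendRen m (j ↑ʳ_)) (matrix Q)

        module _ (M : Structure τ ℓ) (ρ : Vec (Carrier M) m)
                 (ys : Vec (Carrier M) j) (zs : Vec (Carrier M) k) where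
          sat-renameP : Sat M renameP (ρ ++ (ys ++ zs)) ⇔ Sat M (θ P) (ρ ++ ys)
          sat-renameP = sat-renameQF M _ _ _
            (lookup-extendRen (_↑ˡ k) ρ (ys ++ zs) ys (lookup-++ˡ ys zs)) (matrix P)

          sat-renameQ : Sat M renameQ (ρ ++ (ys ++ zs)) ⇔ Sat M (θ Q) (ρ ++ zs)
          sat-renameQ = sat-renameQF M _ _ _
            (lookup-extendRen (j ↑ʳ_) ρ (ys ++ zs) zs (lookup-++ʳ ys zs)) (matrix Q)

      prenex-∧ : Prenex ℓ (φ ∧' ψ)
      prenex-∧ = record
        { width   = j + k
        ; matrix  = and (renameQF-posQF _ (matrix P)) (renameQF-posQF _ (matrix Q))
        ; sound   = λ M ρ → elim-++ j _ λ ys zs (x , y) →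
            sound P M ρ ys (to (sat-renameP M ρ ys zs) x) ,
            sound Q M ρ zs (to (sat-renameQ M ρ ys zs) y)
        ; witness = λ M d ρ (x , y) →
            let ys , x′ = witness P M d ρ x ; zs , y′ = witness Q M d ρ y in
            ys ++ zs , from (sat-renameP M ρ ys zs) x′ , from (sat-renameQ M ρ ys zs) y′ }

      prenex-∨ : Prenex ℓ (φ ∨' ψ)
      prenex-∨ = record
        { width   = j + k
        ; matrix  = or (renameQF-posQF _ (matrix P)) (renameQF-posQF _ (matrix Q))
        ; sound   = λ M ρ → elim-++ j _ λ ys zs →
            [ (λ x → inj₁ (sound P M ρ ys (to (sat-renameP M ρ ys zs) x)))
            , (λ y → inj₂ (sound Q M ρ zs (to (sat-renameQ M ρ ys zs) y))) ]′
        ; witness = λ M d ρ →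
            [ (λ x → let ys , x′ = witness P M d ρ x ; zs = replicate k d in
                     ys ++ zs , inj₁ (from (sat-renameP M ρ ys zs) x′))
            , (λ y → let zs , y′ = witness Q M d ρ y ; ys = replicate j d in
                     ys ++ zs , inj₂ (from (sat-renameQ M ρ ys zs) y′)) ]′ }

    prenex-∃ : ∀ {m} {φ : Formula τ (suc m)} → Prenex ℓ φ → Prenex ℓ (∃' φ)
    prenex-∃ {m} P = record
      { width   = suc (width P)
      ; matrix  = renameQF-posQF _ (matrix P)
      ; sound   = λ { M ρ (x ∷ ys) s → x , sound P M (x ∷ ρ) ys (to (sat-move M ρ x ys) s) }
      ; witness = λ M d ρ (x , s) →
          let ys , s′ = witness P M d (x ∷ ρ) s in x ∷ ys , from (sat-move M ρ x ys) s′ }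
      where
        sat-move : ∀ M ρ x ys → Sat M (renameQF (moveBinder m (width P)) (matrix P)) (ρ ++ (x ∷ ys))
                                ⇔ Sat M (θ P) (x ∷ (ρ ++ ys))
        sat-move M ρ x ys = sat-renameQF M _ _ _ (lookup-moveBinder ρ x ys) (matrix P)

    prenex : ∀ {m} {φ : Formula τ m} → ExPos φ → Prenex ℓ φ
    prenex tt'        = prenex-posQF tt'
    prenex ff'        = prenex-posQF ff'
    prenex (rel R ts) = prenex-posQF (rel R ts)
    prenex (eq s t)   = prenex-posQF (eq s t)
    prenex (and p q)  = prenex-∧ (prenex p) (prenex q)
    prenex (or p q)   = prenex-∨ (prenex p) (prenex q)
    prenex (ex p)     = prenex-∃ (prenex p)

  module _ {ℓ : Level} {S T : Theory τ}
           (hUniversal-S⇒T : ∀ χ → HUniversal χ → S ⊨[ ℓ ] χ → T ⊨[ ℓ ] χ) where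

    unsat-exPos-transfer : ∀ {m} {φ : Formula τ m} → ExPos φ →
      (∀ M → Model M S → ∀ ρ → ¬ Sat M φ ρ) →
      ∀ M → Model M T → Carrier M → ∀ ρ → ¬ Sat M φ ρ
    unsat-exPos-transfer {m} e unsat-S M M⊨T d ρ x =
      let ys , x′ = witness M d ρ x in lower (to (sat-closeAll M _ _) (T⊨χ M M⊨T) (ρ ++ ys) x′)
      where
        open Prenex (prenex {ℓ} e)
        χ : Sentence τ
        χ = closeAll (m + width) (θ ⇒' ff')

        T⊨χ : T ⊨[ ℓ ] χ
        T⊨χ = hUniversal-S⇒T χ (_ , _ , matrix , refl) λ N N⊨S →
          from (sat-closeAll N _ _) (elim-++ m _ λ ρ ys s → lift (unsat-S N N⊨S ρ (sound N ρ ys s)))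

    module _ (em : ExcludedMiddle ℓ) (S-mcc : ModelCompleteCore ℓ S)
             {B A : Structure τ ℓ} (B⊨S : Model B S) (A⊨T : Model A T)
             {t : Carrier B → Carrier A} (t-hom : IsHom B A t) where

      sat-hom-reflects-exPos : Carrier A → ∀ {m} {ψ : Formula τ m} → ExPos ψ →
                               ∀ ρ → Sat A ψ (map t ρ) → Sat B ψ ρ
      sat-hom-reflects-exPos d {m} {ψ} e ρ x with em {Sat B ψ ρ}
      ... | yes y = y
      ... | no ¬y = ⊥-elim (unsat-exPos-transfer (and e e-χ) unsat-S A A⊨T d (map t ρ)
                             (x , sat-hom-exPos t-hom e-χ ρ (to (¬ψ⇔χ B B⊨S ρ) (λ y → ⊥-elim (¬y y)))))
        where
          χ : Formula τ m
          χ = proj₁ (S-mcc m (¬' ψ))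
          e-χ : ExPos χ
          e-χ = proj₁ (proj₂ (S-mcc m (¬' ψ)))
          ¬ψ⇔χ : ∀ M → Model M S → ∀ ρ → Sat M (¬' ψ) ρ ⇔ Sat M χ ρ
          ¬ψ⇔χ = proj₂ (proj₂ (S-mcc m (¬' ψ)))

          unsat-S : ∀ M → Model M S → ∀ ρ → ¬ Sat M (ψ ∧' χ) ρ
          unsat-S M M⊨S ρ (y , z) = lower (from (¬ψ⇔χ M M⊨S ρ) z y)

      sat-hom-exPos-equivalent : ∀ {m} (φ : Formula τ m) →
        Σ (Formula τ m) λ ψ → Carrier A → ∀ ρ → Sat B φ ρ ⇔ Sat A ψ (map t ρ)
      sat-hom-exPos-equivalent {m} φ =
        let ψ , e , φ⇔ψ = S-mcc m φ in
        ψ , λ d ρ → mk⇔ (λ x → sat-hom-exPos t-hom e ρ (to (φ⇔ψ B B⊨S ρ) x))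
                      (λ x → from (φ⇔ψ B B⊨S ρ) (sat-hom-reflects-exPos d e ρ x))

      -- Without traced variables there is no element of 𝔄 at hand, but then
      -- φ only speaks about the parameters and is traced by ⊤ or ⊥.
      hom-traceDef : TraceDef A B 1 (λ b → t b ∷ [])
      hom-traceDef zero k φ p with em {Sat B φ p}
      ... | yes x = 0 , tt' , [] , λ { [] → mk⇔ (λ _ → lift tt) (λ _ → x) }
      ... | no ¬x = 0 , ff' , [] , λ { [] → mk⇔ (λ x → ⊥-elim (¬x x)) (λ x → ⊥-elim (lower x)) }
      hom-traceDef (suc n) k φ p = k , subst (Formula τ) e ψ , map t p , traced
        where
          e : suc n + k ≡ suc n * 1 + k
          e = cong (_+ k) (sym (*-identityʳ (suc n)))

          ψ : Formula τ (suc n + k)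
          ψ = proj₁ (sat-hom-exPos-equivalent φ)

          traced : ∀ as → Sat B φ (as ++ p) ⇔
                          Sat A (subst (Formula τ) e ψ) (concat (map (λ b → t b ∷ []) as) ++ map t p)
          traced as@(b ∷ _) =
            sat-subst-cast A e ψ (cast-map-++-singletons t e as p)
            ⇔-∘ proj₂ (sat-hom-exPos-equivalent φ) (t b) (as ++ p)

lemma3p46 : ∀ {ℓ : Level} → ExcludedMiddle ℓ →
    (τ : Signature) (T S : Theory τ) → Complete ℓ T → CoreCompanion ℓ S T →
    (B : Structure τ ℓ) → Model B S → (A : Structure τ ℓ) → Model A T →
    (t : Carrier B → Carrier A) → IsHom B A t →
    TraceDef A B 1 (λ b → t b ∷ []) × TraceDefines ℓ T S
lemma3p46 em τ T S _ (S-mcc , same-hUniversal) B B⊨S A A⊨T t t-hom =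
  trace , B , B⊨S , A , A⊨T , 1 , _ , trace
  where
    trace : TraceDef A B 1 (λ b → t b ∷ [])
    trace = hom-traceDef (λ χ hχ → to (same-hUniversal χ hχ)) em S-mcc B⊨S A⊨T t-hom
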